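{- Let $K \ge 2$ and $M \ge K$ be integers. There exist pairwise disjoint finite sets of primes $\mathcal{P}_2, \mathcal{P}_3, \dots, \mathcal{P}_K$, with union $\mathcal{P} = \bigcup_{a=2}^K \mathcal{P}_a$, such that, writing $q_p := P(a^p - 1)$ for $p \in \mathcal{P}_a$: (i) for every $2 \le a \le K$ and every $p \in \mathcal{P}_a$, $q_p > K$; (ii) the primes $q_p$ are distinct for distinct $p \in \mathcal{P}$; (iii) for every $2 \le a \le K$, $\sum_{p \in \mathcal{P}_a} \frac{1}{p} \ge M$.
   Context: For an integer $n \ge 2$, $P(n)$ denotes the largest prime divisor of $n$. -}

module Defs where

open import Data.Nat using (ℕ; zero; suc; _≤_; _∸_; _^_)
open import Data.Nat.Divisibility using (_∣_)
open import Data.Nat.Primality using (Prime)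
open import Data.Integer using (+_)
open import Data.Rational using (ℚ; _/_; 0ℚ; _+_)
open import Data.List using (List; []; _∷_)
open import Data.Product using (_×_)

IsLargestPrimeDivisor : ℕ → ℕ → Set
IsLargestPrimeDivisor n q = Prime q × q ∣ n × (∀ r → Prime r → r ∣ n → r ≤ q)

-- reciprocal 1/n as a rational (convention 1/0 = 0; only applied to primes)
recip : ℕ → ℚ
recip zero = 0ℚ
recip (suc n) = (+ 1) / suc n

sumRecip : List ℕ → ℚ
sumRecip [] = 0ℚ
sumRecip (p ∷ ps) = recip p + sumRecip ps

ℕtoℚ : ℕ → ℚ
ℕtoℚ m = (+ m) / 1

{-# OPTIONS --safe #-}

-- For a prime p, every prime divisor r of (aᵖ − 1)/(a − 1) is at least p: if r < p, the exponents e
-- with aᵉ ≡ 1 (mod r) include p and, by pigeonhole, some 0 < d < p, so by Bézout a ≡ 1 (mod r); but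
-- (aᵖ − 1)/(a − 1) ≡ p (mod a − 1), so r ∣ p. Hence p ≤ P(aᵖ − 1) < aᵖ. For p ≠ p′ the common prime
-- divisors of aᵖ − 1 and aᵖ′ − 1 divide a − 1 < K. Taking 𝒫_a to be all primes of an interval
-- (X_a, Y_a] with K ≤ X_a and a ^ Y_a ≤ X_(a+1), the largest prime divisors belonging to 𝒫_a lie below
-- every prime of a later block, and so below its largest prime divisors. The intervals can be made long
-- enough for Σ 1/p ≥ M by Erdős's counting argument: few numbers up to N are X-smooth, and all
-- others are multiples of primes in (X, N].

module Submission where

open import Defs
open import Data.Nat using (ℕ; _≤_; _<_; _∸_; _^_)
open import Data.Nat.Primality using (Prime)
open import Data.Rational using (ℚ) renaming (_≤_ to _≤ℚ_)
open import Data.List using (List)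
open import Data.List.Membership.Propositional using (_∈_)
open import Data.List.Relation.Unary.All using (All)
open import Data.List.Relation.Unary.Unique.Propositional using (Unique)
open import Data.Product using (Σ; _×_)
open import Relation.Binary.PropositionalEquality using (_≡_; _≢_)
open import Data.Empty using (⊥)

open import Data.Nat hiding (_/_)
import Data.Nat as ℕ
open import Data.Nat.Properties
open import Data.Nat.DivMod using (m%n<n; %-distribˡ-*; %-remove-+ˡ; m≡m%n+[m/n]*n)
open import Data.Nat.Divisibility
open import Data.Nat.Primality
open import Data.Nat.Primality.Factorisation using (factorise)
open import Data.Nat.Coprimality using (Coprime; coprime-Bézout; prime⇒coprime)
import Data.Nat.Coprimality as Coprime
open import Data.Nat.GCD using (module Bézout)
open import Data.Nat.Induction using (<-rec)
open import Data.Nat.ListAction using (sum; product)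
open import Data.Nat.Tactic.RingSolver using (solve-∀)
import Algebra.Properties.CommutativeSemigroup as CommutativeSemigroupProperties
open CommutativeSemigroupProperties +-commutativeSemigroup using () renaming (interchange to +-interchange)
open CommutativeSemigroupProperties *-commutativeSemigroup using () renaming (x∙yz≈y∙xz to *-xyz≡yxz)
open import Data.Fin using (toℕ; fromℕ<)
open import Data.Fin.Properties using (pigeonhole; toℕ-fromℕ<; toℕ<n)
open import Data.List using ([]; _∷_; [_]; _++_; map; length; replicate; upTo; cartesianProductWith)
open import Data.List.Properties using (length-++; length-map; length-upTo; length-replicate)
open import Data.List.Membership.DecPropositional _≟_ using (_∈?_)
open import Data.List.Membership.Propositional.Properties using (∈-map⁺; ∈-upTo⁺)
open import Data.List.Relation.Unary.Any using (here; there)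
import Data.List.Relation.Unary.Any.Properties as Any
open import Data.List.Relation.Unary.All as All using ([]; _∷_)
import Data.List.Relation.Unary.AllPairs as AllPairs
open import Data.Product using (∃; _,_; proj₁; proj₂)
open import Data.Sum using (_⊎_; inj₁; inj₂)
open import Data.Empty using (⊥-elim)
open import Relation.Nullary using (¬_; Dec; yes; no)
open import Relation.Nullary.Decidable using (_×-dec_)
open import Relation.Binary.PropositionalEquality hiding ([_])
open import Relation.Binary.Definitions using (tri<; tri≈; tri>)

import Data.Integer as ℤ
import Data.Integer.Properties as ℤ
import Data.Integer.Tactic.RingSolver as ℤ-Solver
open import Data.Rational using (toℚᵘ)
import Data.Rational.Properties as ℚ
open import Data.Rational.Unnormalised using (ℚᵘ; 0ℚᵘ; ½; _/_; *≡*; *≤*)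
  renaming (_≤_ to _≤ᵘ_; _≃_ to _≃ᵘ_; _+_ to _+ᵘ_)
import Data.Rational.Unnormalised.Properties as ℚᵘ

module Modulo (r : ℕ) .{{_ : NonZero r}} where

  infix 4 _≋_
  _≋_ : ℕ → ℕ → Set
  x ≋ y = x % r ≡ y % r

  *-cong-≋ : ∀ {x x′ y y′} → x ≋ x′ → y ≋ y′ → x * y ≋ x′ * y′
  *-cong-≋ {x} {x′} {y} {y′} x≋x′ y≋y′ = begin
    (x * y) % r                ≡⟨ %-distribˡ-* x y r ⟩
    ((x % r) * (y % r)) % r    ≡⟨ cong₂ (λ u v → (u * v) % r) x≋x′ y≋y′ ⟩
    ((x′ % r) * (y′ % r)) % r  ≡⟨ %-distribˡ-* x′ y′ r ⟨
    (x′ * y′) % r              ∎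
    where open ≡-Reasoning

  ^-≋1 : ∀ {x} k → x ≋ 1 → x ^ k ≋ 1
  ^-≋1 zero    x≋1 = refl
  ^-≋1 (suc k) x≋1 = *-cong-≋ x≋1 (^-≋1 k x≋1)

  ^*-≋1 : ∀ a m k → a ^ m ≋ 1 → a ^ (k * m) ≋ 1
  ^*-≋1 a m k aᵐ≋1 =
    trans (cong (_% r) (trans (cong (a ^_) (*-comm k m)) (sym (^-*-assoc a m k)))) (^-≋1 k aᵐ≋1)

  ^suc-≋1 : ∀ a u → a ^ suc u ≋ 1 → a ^ u ≋ 1 → a ≋ 1
  ^suc-≋1 a u aˢᵘ≋1 aᵘ≋1 = begin
    a % r            ≡⟨ cong (_% r) (*-identityʳ a) ⟨
    (a * 1) % r      ≡⟨ *-cong-≋ {a} refl (sym aᵘ≋1) ⟩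
    (a * a ^ u) % r  ≡⟨ aˢᵘ≋1 ⟩
    1 % r            ∎
    where open ≡-Reasoning

  coprime-exponents-≋1 : ∀ a m n → Coprime m n → a ^ m ≋ 1 → a ^ n ≋ 1 → a ≋ 1
  coprime-exponents-≋1 a m n c aᵐ≋1 aⁿ≋1 with coprime-Bézout c
  ... | Bézout.+- x y eq =
    ^suc-≋1 a (y * n) (subst (λ e → a ^ e ≋ 1) (sym eq) (^*-≋1 a m x aᵐ≋1)) (^*-≋1 a n y aⁿ≋1)
  ... | Bézout.-+ x y eq =
    ^suc-≋1 a (x * m) (subst (λ e → a ^ e ≋ 1) (sym eq) (^*-≋1 a n y aⁿ≋1)) (^*-≋1 a m x aᵐ≋1)

  ∣∸1⇒≋1 : ∀ {x} → 1 ≤ x → r ∣ x ∸ 1 → x ≋ 1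
  ∣∸1⇒≋1 {x} 1≤x r∣x∸1 = trans (cong (_% r) (sym (m∸n+n≡m 1≤x))) (%-remove-+ˡ 1 r∣x∸1)

  ≋⇒∣∸ : ∀ {x y} → y ≤ x → x ≋ y → r ∣ x ∸ y
  ≋⇒∣∸ {x} {y} y≤x x≋y = divides (qx ∸ qy) (begin
    x ∸ y                                ≡⟨ cong₂ _∸_ (m≡m%n+[m/n]*n x r) (m≡m%n+[m/n]*n y r) ⟩
    (x % r + qx * r) ∸ (y % r + qy * r)  ≡⟨ cong (λ t → (t + qx * r) ∸ (y % r + qy * r)) x≋y ⟩
    (y % r + qx * r) ∸ (y % r + qy * r)  ≡⟨ [m+n]∸[m+o]≡n∸o (y % r) _ _ ⟩
    qx * r ∸ qy * r                      ≡⟨ *-distribʳ-∸ r qx qy ⟨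
    (qx ∸ qy) * r                        ∎)
    where
    open ≡-Reasoning
    qx = x ℕ./ r
    qy = y ℕ./ r

  -- Among a⁰, …, aᵖ⁻¹ two agree modulo r; aᵖ ≋ 1 makes a invertible, so their quotient is a power ≋ 1.
  short-period : ∀ {a p} → r < p → a ^ p ≋ 1 → ∃ λ d → 0 < d × d < p × a ^ d ≋ 1
  short-period {a} {p} r<p aᵖ≋1 with pigeonhole r<p (λ i → fromℕ< (m%n<n (a ^ toℕ i) r))
  ... | i , j , i<j , fi≡fj = j′ ∸ i′ , m<n⇒0<n∸m i<j , d<p , aᵈ≋1
    where
    i′ = toℕ i
    j′ = toℕ j
    d = j′ ∸ i′
    i≤p : i′ ≤ p
    i≤p = <⇒≤ (<-trans i<j (toℕ<n j))
    d<p : d < p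
    d<p = ≤-<-trans (m∸n≤m j′ i′) (toℕ<n j)
    aⁱ≋aʲ : a ^ i′ ≋ a ^ j′
    aⁱ≋aʲ = trans (sym (toℕ-fromℕ< _)) (trans (cong toℕ fi≡fj) (toℕ-fromℕ< _))
    p+d≡p∸i+j : p + d ≡ (p ∸ i′) + j′
    p+d≡p∸i+j = begin
      p + d                  ≡⟨ cong (_+ d) (m∸n+n≡m i≤p) ⟨
      (p ∸ i′ + i′) + d      ≡⟨ +-assoc (p ∸ i′) i′ d ⟩
      (p ∸ i′) + (i′ + d)    ≡⟨ cong ((p ∸ i′) +_) (m+[n∸m]≡n (<⇒≤ i<j)) ⟩
      (p ∸ i′) + j′          ∎
      where open ≡-Reasoning
    aᵈ≋1 : a ^ d ≋ 1
    aᵈ≋1 = begin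
      (a ^ d) % r                  ≡⟨ cong (_% r) (*-identityˡ (a ^ d)) ⟨
      (1 * a ^ d) % r              ≡⟨ *-cong-≋ {1} (sym aᵖ≋1) refl ⟩
      (a ^ p * a ^ d) % r          ≡⟨ cong (_% r) (trans (sym (^-distribˡ-+-* a p d)) (cong (a ^_) p+d≡p∸i+j)) ⟩
      (a ^ (p ∸ i′ + j′)) % r      ≡⟨ cong (_% r) (^-distribˡ-+-* a (p ∸ i′) j′) ⟩
      (a ^ (p ∸ i′) * a ^ j′) % r  ≡⟨ *-cong-≋ {a ^ (p ∸ i′)} refl (sym aⁱ≋aʲ) ⟩
      (a ^ (p ∸ i′) * a ^ i′) % r  ≡⟨ cong (_% r) (trans (cong (a ^_) (sym (m∸n+n≡m i≤p)))
                                                          (^-distribˡ-+-* a (p ∸ i′) i′)) ⟨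
      (a ^ p) % r                  ≡⟨ aᵖ≋1 ⟩
      1 % r                        ∎
      where open ≡-Reasoning

  prime-exponent-≋1 : ∀ {a p} → Prime p → r < p → a ^ p ≋ 1 → a ≋ 1
  prime-exponent-≋1 {a} {p} pp r<p aᵖ≋1 with short-period r<p aᵖ≋1
  ... | d , 0<d , d<p , aᵈ≋1 =
    coprime-exponents-≋1 a d p (Coprime.sym (prime⇒coprime pp {{>-nonZero 0<d}} d<p)) aᵈ≋1 aᵖ≋1

-- Prime divisors of aᵖ − 1

repunit : ℕ → ℕ → ℕ
repunit b zero    = 0
repunit b (suc k) = 1 + suc b * repunit b k

^∸1≡*repunit : ∀ b k → suc b ^ k ∸ 1 ≡ b * repunit b k
^∸1≡*repunit b k = trans (cong (_∸ 1) (^≡*repunit+1 k)) (m+n∸n≡m (b * repunit b k) 1)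
  where
  step : ∀ b g → suc b * (b * g + 1) ≡ b * (1 + suc b * g) + 1
  step = solve-∀
  ^≡*repunit+1 : ∀ k → suc b ^ k ≡ b * repunit b k + 1
  ^≡*repunit+1 zero    = cong (_+ 1) (sym (*-zeroʳ b))
  ^≡*repunit+1 (suc k) = trans (cong (suc b *_) (^≡*repunit+1 k)) (step b (repunit b k))

repunit≡length+multiple : ∀ b k → ∃ λ t → repunit b k ≡ k + b * t
repunit≡length+multiple b zero = 0 , sym (*-zeroʳ b)
repunit≡length+multiple b (suc k) with repunit≡length+multiple b k
... | t , eq = t + (k + b * t) , trans (cong (λ g → 1 + suc b * g) eq) (step b k t)
  where
  step : ∀ b k t → 1 + suc b * (k + b * t) ≡ suc k + b * (t + (k + b * t))
  step = solve-∀

repunit≥2 : ∀ b k → 2 ≤ k → 2 ≤ repunit b k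
repunit≥2 b (suc (suc k)) _         = s≤s (s≤s z≤n)
repunit≥2 b (suc zero)    (s≤s ())

prime≥2 : ∀ {p} → Prime p → 2 ≤ p
prime≥2 {p} pp = nonTrivial⇒n>1 p {{prime⇒nonTrivial pp}}

∃prime-divisor : ∀ n → 2 ≤ n → ∃ λ r → Prime r × r ∣ n
∃prime-divisor (suc zero)       (s≤s ())
∃prime-divisor n@(suc (suc _)) _ with factorise n
... | record { factors = [] ; isFactorisation = () }
... | record { factors = p ∷ ps ; isFactorisation = eq ; factorsPrime = pp ∷ _ } =
  p , pp , subst (p ∣_) (sym eq) (m∣m*n (product ps))

repunit-small-prime-divisor∣ : ∀ b {p r} → Prime p → Prime r → r < p → r ∣ repunit b p → r ∣ p
repunit-small-prime-divisor∣ b {p} {r} pp pr r<p r∣rep with repunit≡length+multiple b p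
... | t , eq = ∣m+n∣m⇒∣n (subst (r ∣_) (trans eq (+-comm p (b * t))) r∣rep) (∣m⇒∣m*n t r∣b)
  where
  instance
    _ : NonZero r
    _ = prime⇒nonZero pr
  open Modulo r
  r∣b : r ∣ b
  r∣b = ≋⇒∣∸ (s≤s z≤n) (prime-exponent-≋1 pp r<p
          (∣∸1⇒≋1 (m^n>0 (suc b) p) (subst (r ∣_) (sym (^∸1≡*repunit b p)) (∣n⇒∣m*n b r∣rep))))

repunit-prime-divisor≥ : ∀ b {p r} → Prime p → Prime r → r ∣ repunit b p → p ≤ r
repunit-prime-divisor≥ b {p} {r} pp pr r∣rep with p ≤? r
... | yes p≤r = p≤r
... | no  p≰r with prime⇒irreducible pp (repunit-small-prime-divisor∣ b pp pr (≰⇒> p≰r) r∣rep)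
...   | inj₁ refl = ⊥-elim (¬prime[1] pr)
...   | inj₂ refl = ⊥-elim (p≰r ≤-refl)

p≤largestPrimeDivisor : ∀ {a p q} → 1 ≤ a → Prime p → IsLargestPrimeDivisor (a ^ p ∸ 1) q → p ≤ q
p≤largestPrimeDivisor {suc b} {p} _ pp (_ , _ , maximal)
  with ∃prime-divisor (repunit b p) (repunit≥2 b p (prime≥2 pp))
... | r , pr , r∣rep =
  ≤-trans (repunit-prime-divisor≥ b pp pr r∣rep)
          (maximal r pr (subst (r ∣_) (sym (^∸1≡*repunit b p)) (∣n⇒∣m*n b r∣rep)))

∣∸1⇒< : ∀ {n q} → 2 ≤ n → q ∣ n ∸ 1 → q < n
∣∸1⇒< {suc n} (s≤s 1≤n) q∣n = s≤s (∣⇒≤ {{>-nonZero 1≤n}} q∣n)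

^≥2 : ∀ {a} p → 2 ≤ a → 1 ≤ p → 2 ≤ a ^ p
^≥2 {a} (suc p) a≥2 _ =
  ≤-trans a≥2 (m≤m*n a (a ^ p) {{>-nonZero (m^n>0 a {{>-nonZero (<⇒≤ a≥2)}} p)}})

distinct-primes-coprime : ∀ {p p′} → Prime p → Prime p′ → p ≢ p′ → Coprime p p′
distinct-primes-coprime {p} {p′} pp pp′ p≢p′ with <-cmp p p′
... | tri< p<p′ _ _ = Coprime.sym (prime⇒coprime pp′ {{prime⇒nonZero pp}} p<p′)
... | tri≈ _ p≡p′ _ = ⊥-elim (p≢p′ p≡p′)
... | tri> _ _ p′<p = prime⇒coprime pp {{prime⇒nonZero pp′}} p′<p

common-prime-divisor∣∸1 : ∀ {a p p′ q} → 1 ≤ a → Prime p → Prime p′ → p ≢ p′ → Prime q →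
                          q ∣ a ^ p ∸ 1 → q ∣ a ^ p′ ∸ 1 → q ∣ a ∸ 1
common-prime-divisor∣∸1 {a} {p} {p′} {q} a≥1 pp pp′ p≢p′ pq q∣aᵖ q∣aᵖ′ =
  ≋⇒∣∸ a≥1 (coprime-exponents-≋1 a p p′ (distinct-primes-coprime pp pp′ p≢p′)
              (∣∸1⇒≋1 (m^n>0 a p) q∣aᵖ) (∣∸1⇒≋1 (m^n>0 a p′) q∣aᵖ′))
  where
  instance
    _ : NonZero q
    _ = prime⇒nonZero pq
    _ : NonZero a
    _ = >-nonZero a≥1
  open Modulo q

*≤*⇒/≤/ : ∀ a b d e .{{_ : NonZero d}} .{{_ : NonZero e}} → a * e ≤ b * d → ℤ.+ a / d ≤ᵘ ℤ.+ b / e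
*≤*⇒/≤/ a b d@(suc _) e@(suc _) ae≤bd = *≤* (subst₂ ℤ._≤_ (ℤ.pos-* a e) (ℤ.pos-* b d) (ℤ.+≤+ ae≤bd))

/+/≃+/ : ∀ a b d .{{_ : NonZero d}} → ℤ.+ a / d +ᵘ ℤ.+ b / d ≃ᵘ ℤ.+ (a + b) / d
/+/≃+/ a b d@(suc _) =
  *≡* (trans (common-denominator (ℤ.+ a) (ℤ.+ b) (ℤ.+ d)) (cong ((ℤ.+ a ℤ.+ ℤ.+ b) ℤ.*_) (ℤ.pos-* d d)))
  where
  common-denominator : ∀ x y s → (x ℤ.* s ℤ.+ y ℤ.* s) ℤ.* s ≡ (x ℤ.+ y) ℤ.* (s ℤ.* s)
  common-denominator = ℤ-Solver.solve-∀

recipᵘ : ℕ → ℚᵘ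
recipᵘ zero    = 0ℚᵘ
recipᵘ (suc n) = ℤ.+ 1 / suc n

sumRecipᵘ : List ℕ → ℚᵘ
sumRecipᵘ []       = 0ℚᵘ
sumRecipᵘ (p ∷ ps) = recipᵘ p +ᵘ sumRecipᵘ ps

sumRecipᵘ-++ : ∀ ps qs → sumRecipᵘ (ps ++ qs) ≃ᵘ sumRecipᵘ ps +ᵘ sumRecipᵘ qs
sumRecipᵘ-++ []       qs = ℚᵘ.≃-sym (ℚᵘ.+-identityˡ (sumRecipᵘ qs))
sumRecipᵘ-++ (p ∷ ps) qs = ℚᵘ.≃-trans (ℚᵘ.+-congʳ (recipᵘ p) (sumRecipᵘ-++ ps qs))
                                      (ℚᵘ.≃-sym (ℚᵘ.+-assoc (recipᵘ p) (sumRecipᵘ ps) (sumRecipᵘ qs)))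

toℚᵘ-sumRecip : ∀ ps → toℚᵘ (sumRecip ps) ≃ᵘ sumRecipᵘ ps
toℚᵘ-sumRecip []       = ℚᵘ.≃-refl
toℚᵘ-sumRecip (p ∷ ps) =
  ℚᵘ.≃-trans (ℚ.toℚᵘ-homo-+ (recip p) (sumRecip ps)) (ℚᵘ.+-cong (toℚᵘ-recip p) (toℚᵘ-sumRecip ps))
  where
  toℚᵘ-recip : ∀ n → toℚᵘ (recip n) ≃ᵘ recipᵘ n
  toℚᵘ-recip zero    = ℚᵘ.≃-refl
  toℚᵘ-recip (suc n) = ℚ.toℚᵘ-fromℚᵘ (ℤ.+ 1 / suc n)

ℕtoℚ≤sumRecip : ∀ M ps → ℤ.+ M / 1 ≤ᵘ sumRecipᵘ ps → ℕtoℚ M ≤ℚ sumRecip ps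
ℕtoℚ≤sumRecip M ps M≤Σ = ℚ.toℚᵘ-cancel-≤
  (ℚᵘ.≤-respˡ-≃ (ℚᵘ.≃-sym (ℚ.toℚᵘ-fromℚᵘ (ℤ.+ M / 1)))
                (ℚᵘ.≤-respʳ-≃ (ℚᵘ.≃-sym (toℚᵘ-sumRecip ps)) M≤Σ))

bounded-counts⇒≤sumRecipᵘ : ∀ (c : ℕ → ℕ) N .{{_ : NonZero N}} ps →
                            All (λ p → 1 ≤ p × c p * p ≤ N) ps → ℤ.+ sum (map c ps) / N ≤ᵘ sumRecipᵘ ps
bounded-counts⇒≤sumRecipᵘ c N []           []                 = *≤*⇒/≤/ 0 0 N 1 z≤n
bounded-counts⇒≤sumRecipᵘ c N (suc p ∷ ps) ((_ , cₚp≤N) ∷ hs) =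
  ℚᵘ.≤-respˡ-≃ (/+/≃+/ (c (suc p)) (sum (map c ps)) N)
    (ℚᵘ.+-mono-≤ (*≤*⇒/≤/ (c (suc p)) 1 N (suc p) (subst (c (suc p) * suc p ≤_) (sym (*-identityˡ N)) cₚp≤N))
                 (bounded-counts⇒≤sumRecipᵘ c N ps hs))

primesIn : ℕ → ℕ → List ℕ
primesIn X zero = []
primesIn X (suc Y) with X <? suc Y ×-dec prime? (suc Y)
... | yes _ = suc Y ∷ primesIn X Y
... | no  _ = primesIn X Y

∈-primesIn⁻ : ∀ X Y {p} → p ∈ primesIn X Y → Prime p × X < p × p ≤ Y
∈-primesIn⁻ X (suc Y) p∈ with X <? suc Y ×-dec prime? (suc Y) | p∈
... | yes (X<p , pp) | here refl = pp , X<p , ≤-refl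
... | yes _          | there p∈′ = let pp , X<p , p≤Y = ∈-primesIn⁻ X Y p∈′ in pp , X<p , m≤n⇒m≤1+n p≤Y
... | no  _          | p∈′       = let pp , X<p , p≤Y = ∈-primesIn⁻ X Y p∈′ in pp , X<p , m≤n⇒m≤1+n p≤Y

∈-primesIn⁺ : ∀ X Y {p} → Prime p → X < p → p ≤ Y → p ∈ primesIn X Y
∈-primesIn⁺ X zero    pp X<p p≤0 = ⊥-elim (n≮0 (<-≤-trans X<p p≤0))
∈-primesIn⁺ X (suc Y) pp X<p p≤Y with X <? suc Y ×-dec prime? (suc Y) | m≤n⇒m<n∨m≡n p≤Y
... | yes _ | inj₂ refl = here refl
... | yes _ | inj₁ p<Y  = there (∈-primesIn⁺ X Y pp X<p (≤-pred p<Y))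
... | no ¬q | inj₂ refl = ⊥-elim (¬q (X<p , pp))
... | no _  | inj₁ p<Y  = ∈-primesIn⁺ X Y pp X<p (≤-pred p<Y)

primesIn-unique : ∀ X Y → Unique (primesIn X Y)
primesIn-unique X zero = AllPairs.[]
primesIn-unique X (suc Y) with X <? suc Y ×-dec prime? (suc Y)
... | yes _ = All.tabulate (λ p∈ Y+1≡p → <⇒≢ (s≤s (proj₂ (proj₂ (∈-primesIn⁻ X Y p∈)))) (sym Y+1≡p))
              AllPairs.∷ primesIn-unique X Y
... | no  _ = primesIn-unique X Y

primesIn-empty : ∀ X Y → Y ≤ X → primesIn X Y ≡ []
primesIn-empty X zero    _   = refl
primesIn-empty X (suc Y) Y<X with X <? suc Y ×-dec prime? (suc Y)
... | yes (X<Y , _) = ⊥-elim (<-irrefl refl (<-≤-trans X<Y Y<X))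
... | no  _         = primesIn-empty X Y (<⇒≤ Y<X)

primesIn-++ : ∀ X Y Z → X ≤ Y → Y ≤ Z → primesIn X Z ≡ primesIn Y Z ++ primesIn X Y
primesIn-++ X Y Z X≤Y Y≤Z = go Z (≤⇒≤′ Y≤Z)
  where
  go : ∀ Z → Y ≤′ Z → primesIn X Z ≡ primesIn Y Z ++ primesIn X Y
  go Z ≤′-refl = cong (_++ primesIn X Y) (sym (primesIn-empty Y Y ≤-refl))
  go (suc Z) (≤′-step Y≤Z) with X <? suc Z ×-dec prime? (suc Z) | Y <? suc Z ×-dec prime? (suc Z)
  ... | yes _        | yes _ = cong (suc Z ∷_) (go Z Y≤Z)
  ... | no  _        | no  _ = go Z Y≤Z
  ... | yes (_ , pp) | no ¬q = ⊥-elim (¬q (s≤s (≤′⇒≤ Y≤Z) , pp))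
  ... | no ¬q        | yes (Y<Z , pp) = ⊥-elim (¬q (≤-<-trans X≤Y Y<Z , pp))

𝟙 : ∀ {A : Set} → Dec A → ℕ
𝟙 (yes _) = 1
𝟙 (no  _) = 0

𝟙-yes : ∀ {A : Set} → A → (d : Dec A) → 1 ≤ 𝟙 d
𝟙-yes a (yes _) = ≤-refl
𝟙-yes a (no ¬a) = ⊥-elim (¬a a)

𝟙-no : ∀ {A : Set} → ¬ A → (d : Dec A) → 𝟙 d ≡ 0
𝟙-no ¬a (yes a) = ⊥-elim (¬a a)
𝟙-no ¬a (no  _) = refl

sumTo : (ℕ → ℕ) → ℕ → ℕ
sumTo g zero    = 0
sumTo g (suc N) = g (suc N) + sumTo g N

sumTo-+ : ∀ g h N → sumTo (λ n → g n + h n) N ≡ sumTo g N + sumTo h N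
sumTo-+ g h zero    = refl
sumTo-+ g h (suc N) = trans (cong (g (suc N) + h (suc N) +_) (sumTo-+ g h N))
                            (+-interchange (g (suc N)) (h (suc N)) (sumTo g N) (sumTo h N))

sumTo-mono-≤ : ∀ {g h} N → (∀ n → g n ≤ h n) → sumTo g N ≤ sumTo h N
sumTo-mono-≤ zero    g≤h = z≤n
sumTo-mono-≤ (suc N) g≤h = +-mono-≤ (g≤h (suc N)) (sumTo-mono-≤ N g≤h)

N≤sumTo : ∀ g N → (∀ n → 1 ≤ n → n ≤ N → 1 ≤ g n) → N ≤ sumTo g N
N≤sumTo g zero    _  = z≤n
N≤sumTo g (suc N) g≥1 =
  +-mono-≤ (g≥1 (suc N) (s≤s z≤n) ≤-refl) (N≤sumTo g N (λ n n≥1 n≤N → g≥1 n n≥1 (m≤n⇒m≤1+n n≤N)))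

sum-map-+ : ∀ (g h : ℕ → ℕ) xs → sum (map (λ x → g x + h x) xs) ≡ sum (map g xs) + sum (map h xs)
sum-map-+ g h []       = refl
sum-map-+ g h (x ∷ xs) = trans (cong (g x + h x +_) (sum-map-+ g h xs))
                               (+-interchange (g x) (h x) (sum (map g xs)) (sum (map h xs)))

sumTo-sum-map : ∀ (h : ℕ → ℕ → ℕ) xs N →
                sumTo (λ n → sum (map (λ x → h x n) xs)) N ≡ sum (map (λ x → sumTo (h x) N) xs)
sumTo-sum-map h xs zero    = sym (sum-map-0 xs)
  where
  sum-map-0 : ∀ xs → sum (map (λ _ → 0) xs) ≡ 0
  sum-map-0 []       = refl
  sum-map-0 (_ ∷ xs) = sum-map-0 xs
sumTo-sum-map h xs (suc N) = trans (cong (sum (map (λ x → h x (suc N)) xs) +_) (sumTo-sum-map h xs N))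
                                   (sym (sum-map-+ (λ x → h x (suc N)) (λ x → sumTo (h x) N) xs))

∈⇒≤sum-map : ∀ (g : ℕ → ℕ) {x xs} → x ∈ xs → g x ≤ sum (map g xs)
∈⇒≤sum-map g {xs = y ∷ xs} (here refl) = m≤m+n (g y) _
∈⇒≤sum-map g {xs = y ∷ xs} (there x∈) = ≤-trans (∈⇒≤sum-map g x∈) (m≤n+m _ (g y))

sumTo-𝟙≟≤1 : ∀ x N → sumTo (λ n → 𝟙 (n ≟ x)) N ≤ 1
sumTo-𝟙≟≤1 x zero    = z≤n
sumTo-𝟙≟≤1 x (suc N) with suc N ≟ x
... | yes refl = s≤s (≤-reflexive (below N ≤-refl))
  where
  below : ∀ M → M ≤ N → sumTo (λ n → 𝟙 (n ≟ suc N)) M ≡ 0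
  below zero    _   = refl
  below (suc M) M<N = cong₂ _+_ (𝟙-no (<⇒≢ (s≤s M<N)) (suc M ≟ suc N)) (below M (<⇒≤ M<N))
... | no  _    = sumTo-𝟙≟≤1 x N

sumTo-𝟙∈≤length : ∀ xs N → sumTo (λ n → 𝟙 (n ∈? xs)) N ≤ length xs
sumTo-𝟙∈≤length []       zero    = z≤n
sumTo-𝟙∈≤length []       (suc N) = sumTo-𝟙∈≤length [] N
sumTo-𝟙∈≤length (x ∷ xs) N = begin
  sumTo (λ n → 𝟙 (n ∈? (x ∷ xs))) N                        ≤⟨ sumTo-mono-≤ N 𝟙∈-∷ ⟩
  sumTo (λ n → 𝟙 (n ≟ x) + 𝟙 (n ∈? xs)) N                  ≡⟨ sumTo-+ _ _ N ⟩
  sumTo (λ n → 𝟙 (n ≟ x)) N + sumTo (λ n → 𝟙 (n ∈? xs)) N  ≤⟨ +-mono-≤ (sumTo-𝟙≟≤1 x N)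
                                                                        (sumTo-𝟙∈≤length xs N) ⟩
  suc (length xs)                                          ∎
  where
  open ≤-Reasoning
  𝟙∈-∷ : ∀ n → 𝟙 (n ∈? (x ∷ xs)) ≤ 𝟙 (n ≟ x) + 𝟙 (n ∈? xs)
  𝟙∈-∷ n with n ∈? (x ∷ xs)
  ... | no  _             = z≤n
  ... | yes (here n≡x)    = ≤-trans (𝟙-yes n≡x (n ≟ x)) (m≤m+n _ _)
  ... | yes (there n∈xs)  = ≤-trans (𝟙-yes n∈xs (n ∈? xs)) (m≤n+m _ _)

multiples : ℕ → ℕ → ℕ
multiples p N = sumTo (λ n → 𝟙 (p ∣? n)) N

multiples*p≤N : ∀ p N → multiples p N * p ≤ N
multiples*p≤N p zero = z≤n
multiples*p≤N p (suc N) with p ∣? suc N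
... | no  _ = m≤n⇒m≤1+n (multiples*p≤N p N)
... | yes (divides k N+1≡k*p) = begin
  suc (multiples p N) * p  ≤⟨ *-monoˡ-≤ p (*-cancelʳ-< p (multiples p N) k mp<kp) ⟩
  k * p                    ≡⟨ N+1≡k*p ⟨
  suc N                    ∎
  where
  open ≤-Reasoning
  mp<kp : multiples p N * p < k * p
  mp<kp = subst (multiples p N * p <_) N+1≡k*p (s≤s (multiples*p≤N p N))

covered⇒≤length+multiples : ∀ N A ps →
                            (∀ n → 1 ≤ n → n ≤ N → n ∈ A ⊎ ∃ λ p → p ∈ ps × p ∣ n) →
                            N ≤ length A + sum (map (λ p → multiples p N) ps)
covered⇒≤length+multiples N A ps covered = begin
  N                                              ≤⟨ N≤sumTo (λ n → inA n + divisible n) N hits ⟩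
  sumTo (λ n → inA n + divisible n) N            ≡⟨ sumTo-+ inA divisible N ⟩
  sumTo inA N + sumTo divisible N                ≤⟨ +-monoˡ-≤ _ (sumTo-𝟙∈≤length A N) ⟩
  length A + sumTo divisible N                   ≡⟨ cong (length A +_) (sumTo-sum-map (λ p n → 𝟙 (p ∣? n)) ps N) ⟩
  length A + sum (map (λ p → multiples p N) ps)  ∎
  where
  open ≤-Reasoning
  inA divisible : ℕ → ℕ
  inA n = 𝟙 (n ∈? A)
  divisible n = sum (map (λ p → 𝟙 (p ∣? n)) ps)
  hits : ∀ n → 1 ≤ n → n ≤ N → 1 ≤ inA n + divisible n
  hits n n≥1 n≤N with covered n n≥1 n≤N
  ... | inj₁ n∈A = ≤-trans (𝟙-yes n∈A (n ∈? A)) (m≤m+n _ _)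
  ... | inj₂ (p , p∈ps , p∣n) =
    ≤-trans (≤-trans (𝟙-yes p∣n (p ∣? n)) (∈⇒≤sum-map (λ q → 𝟙 (q ∣? n)) p∈ps)) (m≤n+m _ _)

powProduct : ℕ → List ℕ → ℕ
powProduct k []       = 1
powProduct k (e ∷ es) = k ^ e * powProduct (suc k) es

bumpExponent : ℕ → ℕ → List ℕ → List ℕ
bumpExponent k p []       = []
bumpExponent k p (e ∷ es) with k ≟ p
... | yes _ = suc e ∷ es
... | no  _ = e ∷ bumpExponent (suc k) p es

length-bumpExponent : ∀ k p es → length (bumpExponent k p es) ≡ length es
length-bumpExponent k p []       = refl
length-bumpExponent k p (e ∷ es) with k ≟ p
... | yes _ = refl
... | no  _ = cong suc (length-bumpExponent (suc k) p es)

powProduct-bumpExponent : ∀ k p es → k ≤ p → p < k + length es →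
                          powProduct k (bumpExponent k p es) ≡ p * powProduct k es
powProduct-bumpExponent k p []       k≤p p<k+0 = ⊥-elim (<⇒≱ (subst (p <_) (+-identityʳ k) p<k+0) k≤p)
powProduct-bumpExponent k p (e ∷ es) k≤p p<k+l with k ≟ p
... | yes refl = *-assoc k (k ^ e) (powProduct (suc k) es)
... | no  k≢p  = trans (cong (k ^ e *_) (powProduct-bumpExponent (suc k) p es (≤∧≢⇒< k≤p k≢p) p<1+k+l))
                       (*-xyz≡yxz (k ^ e) p (powProduct (suc k) es))
  where
  p<1+k+l : p < suc k + length es
  p<1+k+l = subst (p <_) (+-suc k (length es)) p<k+l

powProduct-zeros : ∀ k m → powProduct k (replicate m 0) ≡ 1
powProduct-zeros k zero    = refl
powProduct-zeros k (suc m) = trans (+-identityʳ _) (powProduct-zeros (suc k) m)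

SmoothOrRough : ℕ → ℕ → Set
SmoothOrRough X n = (∃ λ es → length es ≡ X ∸ 1 × powProduct 2 es ≡ n)
                  ⊎ (∃ λ p → Prime p × X < p × p ∣ n)

smoothOrRough : ∀ X n → 1 ≤ n → SmoothOrRough X n
smoothOrRough X = <-rec (λ n → 1 ≤ n → SmoothOrRough X n) go
  where
  go : ∀ n → (∀ {m} → m < n → 1 ≤ m → SmoothOrRough X m) → 1 ≤ n → SmoothOrRough X n
  go 1 _ _ = inj₁ (replicate (X ∸ 1) 0 , length-replicate (X ∸ 1) , powProduct-zeros 2 (X ∸ 1))
  go n@(suc (suc _)) rec _ with ∃prime-divisor n (s≤s (s≤s z≤n))
  ... | p , pp , p∣n with X <? p
  ...   | yes X<p = inj₂ (p , pp , X<p , p∣n)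
  ...   | no  X≮p with rec (quotient-< p∣n {{prime⇒nonTrivial pp}}) (>-nonZero⁻¹ _ {{quotient≢0 p∣n}})
  ...     | inj₂ (r , pr , X<r , r∣n/p) = inj₂ (r , pr , X<r , ∣-trans r∣n/p (quotient-∣ p∣n))
  ...     | inj₁ (es , len , n/p≡) =
    inj₁ (bumpExponent 2 p es , trans (length-bumpExponent 2 p es) len ,
          trans (powProduct-bumpExponent 2 p es (prime≥2 pp) p<2+len)
                (trans (cong (p *_) n/p≡) (sym (m∣n⇒n≡m*quotient p∣n))))
    where
    p≤X : p ≤ X
    p≤X = ≮⇒≥ X≮p
    p<2+len : p < 2 + length es
    p<2+len = subst (λ l → p < 2 + l) (sym len) (s≤s (≤-trans p≤X (m≤n+m∸n X 1)))

powProduct≥1 : ∀ k es → 1 ≤ k → 1 ≤ powProduct k es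
powProduct≥1 k []       _   = ≤-refl
powProduct≥1 k (e ∷ es) k≥1 = *-mono-≤ (m^n>0 k {{>-nonZero k≥1}} e) (powProduct≥1 (suc k) es (s≤s z≤n))

2^exponent≤powProduct : ∀ k es → 2 ≤ k → All (λ e → 2 ^ e ≤ powProduct k es) es
2^exponent≤powProduct k []       _   = []
2^exponent≤powProduct k (e ∷ es) k≥2 =
  ≤-trans (^-monoˡ-≤ e k≥2) (m≤m*n (k ^ e) (powProduct (suc k) es) {{rest≢0}})
  ∷ All.map (λ h → ≤-trans h (m≤n*m (powProduct (suc k) es) (k ^ e) {{kᵉ≢0}}))
            (2^exponent≤powProduct (suc k) es (m≤n⇒m≤1+n k≥2))
  where
  rest≢0 = >-nonZero (powProduct≥1 (suc k) es (s≤s z≤n))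
  kᵉ≢0 = >-nonZero (m^n>0 k {{>-nonZero (<⇒≤ k≥2)}} e)

2^-cancel-≤ : ∀ e L → 2 ^ e ≤ 2 ^ L → e ≤ L
2^-cancel-≤ e L 2ᵉ≤2ᴸ with e ≤? L
... | yes e≤L = e≤L
... | no  e≰L = ⊥-elim (<⇒≱ (^-monoʳ-< 2 (s≤s (s≤s z≤n)) (≰⇒> e≰L)) 2ᵉ≤2ᴸ)

exponentVectors : ℕ → ℕ → List (List ℕ)
exponentVectors zero    B = [ [] ]
exponentVectors (suc m) B = cartesianProductWith _∷_ (upTo B) (exponentVectors m B)

length-cartesianProductWith : ∀ {A B C : Set} (f : A → B → C) xs ys →
                              length (cartesianProductWith f xs ys) ≡ length xs * length ys
length-cartesianProductWith f []       ys = refl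
length-cartesianProductWith f (x ∷ xs) ys =
  trans (length-++ (map (f x) ys)) (cong₂ _+_ (length-map (f x) ys) (length-cartesianProductWith f xs ys))

length-exponentVectors : ∀ m B → length (exponentVectors m B) ≡ B ^ m
length-exponentVectors zero    B = refl
length-exponentVectors (suc m) B =
  trans (length-cartesianProductWith _∷_ (upTo B) (exponentVectors m B))
        (cong₂ _*_ (length-upTo B) (length-exponentVectors m B))

∈-exponentVectors : ∀ m B es → length es ≡ m → All (_< B) es → es ∈ exponentVectors m B
∈-exponentVectors zero    B []       refl []         = here refl
∈-exponentVectors (suc m) B (e ∷ es) refl (e<B ∷ es<B) =
  Any.cartesianProductWith⁺ _∷_ (λ { refl refl → refl }) (∈-upTo⁺ e<B) (∈-exponentVectors m B es refl es<B)

-- Intervals of primes with large Σ 1/p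

n<2^n : ∀ n → n < 2 ^ n
n<2^n zero    = s≤s z≤n
n<2^n (suc n) = +-mono-≤ (m^n>0 2 n) (≤-trans (n<2^n n) (m≤m+n (2 ^ n) 0))

1+2n≤2^[1+n] : ∀ n → 1 + 2 * n ≤ 2 ^ suc n
1+2n≤2^[1+n] zero    = s≤s z≤n
1+2n≤2^[1+n] (suc n) = begin
  1 + 2 * suc n         ≡⟨ cong suc (*-suc 2 n) ⟩
  2 + (1 + 2 * n)       ≤⟨ +-mono-≤ (^-monoʳ-≤ 2 {1} {suc n} (s≤s z≤n)) (1+2n≤2^[1+n] n) ⟩
  2 ^ suc n + 2 ^ suc n ≡⟨ cong (2 ^ suc n +_) (+-identityʳ (2 ^ suc n)) ⟨
  2 ^ suc (suc n)       ∎
  where open ≤-Reasoning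

2*[1+L]^m≤2^L : ∀ m → let L = 2 ^ (2 * m + 2) in 2 * suc L ^ m ≤ 2 ^ L
2*[1+L]^m≤2^L m = begin
  2 * suc L ^ m              ≤⟨ *-monoʳ-≤ 2 (^-monoˡ-≤ m 1+L≤2^[1+t]) ⟩
  2 * (2 ^ suc t) ^ m        ≡⟨ cong (2 *_) (^-*-assoc 2 (suc t) m) ⟩
  2 ^ suc (suc t * m)        ≤⟨ ^-monoʳ-≤ 2 1+[1+t]m≤L ⟩
  2 ^ L                      ∎
  where
  open ≤-Reasoning
  t = 2 * m + 2
  L = 2 ^ t
  1+L≤2^[1+t] : suc L ≤ 2 ^ suc t
  1+L≤2^[1+t] = subst (_≤ 2 ^ suc t) (+-comm L 1)
                  (+-monoʳ-≤ L (≤-trans (m^n>0 2 t) (≤-reflexive (sym (+-identityʳ L)))))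
  1+[1+t]m≤L : suc (suc t * m) ≤ L
  1+[1+t]m≤L = begin
    suc (suc t * m)            ≡⟨ factor m ⟩
    (1 + 2 * m) * suc m        ≤⟨ *-mono-≤ (1+2n≤2^[1+n] m) (<⇒≤ (n<2^n (suc m))) ⟩
    2 ^ suc m * 2 ^ suc m      ≡⟨ ^-distribˡ-+-* 2 (suc m) (suc m) ⟨
    2 ^ (suc m + suc m)        ≡⟨ cong (2 ^_) (double m) ⟩
    L                          ∎
    where
    factor : ∀ m → suc (suc (2 * m + 2) * m) ≡ (1 + 2 * m) * suc m
    factor = solve-∀
    double : ∀ m → suc m + suc m ≡ 2 * m + 2
    double = solve-∀

-- Of 1, …, N = 2 ^ L at most (1 + L) ^ (X − 1) ≤ N / 2 are X-smooth; every other one is a multiple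
-- of a prime p ∈ (X, N], and there are at most N / p of those, so Σ N / p ≥ N / 2.
primesIn-sumRecip≥½ : ∀ X → ∃ λ Y → X ≤ Y × ½ ≤ᵘ sumRecipᵘ (primesIn X Y)
primesIn-sumRecip≥½ X = N , X≤N , ½≤Σ
  where
  m = X ∸ 1
  L = 2 ^ (2 * m + 2)
  N = 2 ^ L
  instance
    N≢0 : NonZero N
    N≢0 = m^n≢0 2 L
  smooth = map (powProduct 2) (exponentVectors m (suc L))
  ps = primesIn X N
  S = sum (map (λ p → multiples p N) ps)

  X≤N : X ≤ N
  X≤N = begin
    X              ≤⟨ m≤n+m∸n X 1 ⟩
    suc m          ≤⟨ m≤n+m (suc m) (suc m) ⟩
    suc m + suc m  ≡⟨ double m ⟩
    2 * m + 2      <⟨ n<2^n (2 * m + 2) ⟩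
    L              <⟨ n<2^n L ⟩
    N              ∎
    where
    open ≤-Reasoning
    double : ∀ m → suc m + suc m ≡ 2 * m + 2
    double = solve-∀

  covered : ∀ n → 1 ≤ n → n ≤ N → n ∈ smooth ⊎ ∃ λ p → p ∈ ps × p ∣ n
  covered n n≥1 n≤N with smoothOrRough X n n≥1
  ... | inj₁ (es , len , es↦n) =
    inj₁ (subst (_∈ smooth) es↦n (∈-map⁺ (powProduct 2) (∈-exponentVectors m (suc L) es len es<1+L)))
    where
    es<1+L : All (_< suc L) es
    es<1+L = All.map (λ 2ᵉ≤n → s≤s (2^-cancel-≤ _ L (≤-trans 2ᵉ≤n (≤-trans (≤-reflexive es↦n) n≤N))))
                     (2^exponent≤powProduct 2 es ≤-refl)
  ... | inj₂ (p , pp , X<p , p∣n) =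
    inj₂ (p , ∈-primesIn⁺ X N pp X<p (≤-trans (∣⇒≤ {{>-nonZero n≥1}} p∣n) n≤N) , p∣n)

  length-smooth : length smooth ≡ suc L ^ m
  length-smooth = trans (length-map (powProduct 2) (exponentVectors m (suc L))) (length-exponentVectors m (suc L))

  N≤2S : N ≤ 2 * S
  N≤2S = +-cancelˡ-≤ N N (2 * S) (begin
    N + N                   ≡⟨ cong (N +_) (+-identityʳ N) ⟨
    2 * N                   ≤⟨ *-monoʳ-≤ 2 (covered⇒≤length+multiples N smooth ps covered) ⟩
    2 * (length smooth + S) ≡⟨ cong (λ l → 2 * (l + S)) length-smooth ⟩
    2 * (suc L ^ m + S)     ≡⟨ *-distribˡ-+ 2 (suc L ^ m) S ⟩
    2 * suc L ^ m + 2 * S   ≤⟨ +-monoˡ-≤ (2 * S) (2*[1+L]^m≤2^L m) ⟩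
    N + 2 * S               ∎)
    where open ≤-Reasoning

  ½≤Σ : ½ ≤ᵘ sumRecipᵘ ps
  ½≤Σ = ℚᵘ.≤-trans (*≤*⇒/≤/ 1 S 2 N (subst₂ _≤_ (sym (*-identityˡ N)) (*-comm 2 S) N≤2S))
          (bounded-counts⇒≤sumRecipᵘ (λ p → multiples p N) N ps
            (All.tabulate (λ p∈ → <⇒≤ (prime≥2 (proj₁ (∈-primesIn⁻ X N p∈))) , multiples*p≤N _ N)))

primesIn-sumRecip≥ : ∀ X k → ∃ λ Y → X ≤ Y × ℤ.+ k / 2 ≤ᵘ sumRecipᵘ (primesIn X Y)
primesIn-sumRecip≥ X zero =
  X , ≤-refl , subst (λ ps → ℤ.+ 0 / 2 ≤ᵘ sumRecipᵘ ps) (sym (primesIn-empty X X ≤-refl))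
                     (*≤*⇒/≤/ 0 0 2 1 z≤n)
primesIn-sumRecip≥ X (suc k) with primesIn-sumRecip≥ X k
... | Y₁ , X≤Y₁ , k/2≤Σ₁ with primesIn-sumRecip≥½ Y₁
...   | Y₂ , Y₁≤Y₂ , ½≤Σ₂ = Y₂ , ≤-trans X≤Y₁ Y₁≤Y₂ ,
  ℚᵘ.≤-respʳ-≃ (ℚᵘ.≃-sym split) (ℚᵘ.≤-respˡ-≃ (/+/≃+/ 1 k 2) (ℚᵘ.+-mono-≤ ½≤Σ₂ k/2≤Σ₁))
  where
  split : sumRecipᵘ (primesIn X Y₂) ≃ᵘ sumRecipᵘ (primesIn Y₁ Y₂) +ᵘ sumRecipᵘ (primesIn X Y₁)
  split = ℚᵘ.≃-trans (ℚᵘ.≃-reflexive (cong sumRecipᵘ (primesIn-++ X Y₁ Y₂ X≤Y₁ Y₁≤Y₂)))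
                     (sumRecipᵘ-++ (primesIn Y₁ Y₂) (primesIn X Y₁))

n<a^n : ∀ {a} n → 2 ≤ a → n < a ^ n
n<a^n {a} n a≥2 = <-≤-trans (n<2^n n) (^-monoˡ-≤ n a≥2)

module Blocks (K M : ℕ) where

  upperFrom : ℕ → ℕ
  upperFrom X = proj₁ (primesIn-sumRecip≥ X (2 * M))

  lower : ℕ → ℕ
  lower zero    = K
  lower (suc a) = K + suc a ^ upperFrom (lower a)

  upper : ℕ → ℕ
  upper a = upperFrom (lower a)

  block : ℕ → List ℕ
  block a = primesIn (lower a) (upper a)

  lower≤upper : ∀ a → lower a ≤ upper a
  lower≤upper a = proj₁ (proj₂ (primesIn-sumRecip≥ (lower a) (2 * M)))

  K≤lower : ∀ a → K ≤ lower a
  K≤lower zero    = ≤-refl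
  K≤lower (suc a) = m≤m+n K _

  lower-mono : ∀ {a b} → a ≤ b → lower a ≤ lower b
  lower-mono {a} {b} a≤b = go b (≤⇒≤′ a≤b)
    where
    step : ∀ a → lower a ≤ lower (suc a)
    step zero    = m≤m+n K _
    step (suc a) = ≤-trans (lower≤upper (suc a))
                     (<⇒≤ (<-≤-trans (n<a^n (upper (suc a)) (s≤s (s≤s z≤n))) (m≤n+m _ K)))
    go : ∀ b → a ≤′ b → lower a ≤ lower b
    go b       ≤′-refl        = ≤-refl
    go (suc b) (≤′-step a≤b) = ≤-trans (go b a≤b) (step b)

  module _ a {p} (p∈ : p ∈ block a) where
    block-prime : Prime p
    block-prime = proj₁ (∈-primesIn⁻ (lower a) (upper a) p∈)

    lower<block : lower a < p
    lower<block = proj₁ (proj₂ (∈-primesIn⁻ (lower a) (upper a) p∈))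

    block≤upper : p ≤ upper a
    block≤upper = proj₂ (proj₂ (∈-primesIn⁻ (lower a) (upper a) p∈))

  ^<later-block : ∀ {a b p p′} → 1 ≤ a → a < b → p ∈ block a → p′ ∈ block b → a ^ p < p′
  ^<later-block {a} {b} {p} a≥1 a<b p∈ p′∈ = <-≤-trans (s≤s (begin
    a ^ p           ≤⟨ ^-monoʳ-≤ a {{>-nonZero a≥1}} (block≤upper a p∈) ⟩
    a ^ upper a     ≤⟨ ^-monoˡ-≤ (upper a) (n≤1+n a) ⟩
    suc a ^ upper a ≤⟨ m≤n+m _ K ⟩
    lower (suc a)   ≤⟨ lower-mono a<b ⟩
    lower b         ∎)) (lower<block b p′∈)
    where open ≤-Reasoning

  K<largestPrimeDivisor : ∀ {a p q} → 1 ≤ a → p ∈ block a → IsLargestPrimeDivisor (a ^ p ∸ 1) q → K < q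
  K<largestPrimeDivisor {a} a≥1 p∈ q-lpd =
    <-≤-trans (≤-<-trans (K≤lower a) (lower<block a p∈)) (p≤largestPrimeDivisor a≥1 (block-prime a p∈) q-lpd)

  blocks-disjoint : ∀ {a b p} → 2 ≤ a → 2 ≤ b → a ≢ b → p ∈ block a → p ∈ block b → ⊥
  blocks-disjoint {a} {b} {p} a≥2 b≥2 a≢b p∈a p∈b with <-cmp a b
  ... | tri< a<b _ _ = <-asym (n<a^n p a≥2) (^<later-block (<⇒≤ a≥2) a<b p∈a p∈b)
  ... | tri≈ _ a≡b _ = a≢b a≡b
  ... | tri> _ _ b<a = <-asym (n<a^n p b≥2) (^<later-block (<⇒≤ b≥2) b<a p∈b p∈a)

  largestPrimeDivisor-<-later : ∀ {a b p p′ q q′} → 2 ≤ a → a < b → p ∈ block a → p′ ∈ block b →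
                                IsLargestPrimeDivisor (a ^ p ∸ 1) q →
                                IsLargestPrimeDivisor (b ^ p′ ∸ 1) q′ → q < q′
  largestPrimeDivisor-<-later {a} {b} {p} a≥2 a<b p∈ p′∈ (_ , q∣ , _) q′-lpd =
    <-≤-trans (<-trans (∣∸1⇒< (^≥2 p a≥2 (<⇒≤ (prime≥2 (block-prime a p∈)))) q∣)
                       (^<later-block (<⇒≤ a≥2) a<b p∈ p′∈))
              (p≤largestPrimeDivisor (<⇒≤ (≤-trans a≥2 (<⇒≤ a<b))) (block-prime b p′∈) q′-lpd)

  largestPrimeDivisor-≢-same-base : ∀ {a p p′ q q′} → 2 ≤ a → a ≤ K →
                                    p ∈ block a → p′ ∈ block a → p ≢ p′ →
                                    IsLargestPrimeDivisor (a ^ p ∸ 1) q →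
                                    IsLargestPrimeDivisor (a ^ p′ ∸ 1) q′ → q ≢ q′
  largestPrimeDivisor-≢-same-base {a} a≥2 a≤K p∈ p′∈ p≢p′ q-lpd@(pq , q∣ , _) (_ , q′∣ , _) refl =
    <-asym (<-≤-trans (∣∸1⇒< a≥2 q∣a∸1) a≤K) (K<largestPrimeDivisor a≥1 p∈ q-lpd)
    where
    a≥1 = <⇒≤ a≥2
    q∣a∸1 = common-prime-divisor∣∸1 a≥1 (block-prime a p∈) (block-prime a p′∈) p≢p′ pq q∣ q′∣

  largestPrimeDivisors-distinct : ∀ {a b p p′ q q′} → 2 ≤ a → a ≤ K → 2 ≤ b → b ≤ K →
                                  p ∈ block a → p′ ∈ block b →
                                  IsLargestPrimeDivisor (a ^ p ∸ 1) q →
                                  IsLargestPrimeDivisor (b ^ p′ ∸ 1) q′ → p ≢ p′ → q ≢ q′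
  largestPrimeDivisors-distinct {a} {b} a≥2 a≤K b≥2 b≤K p∈ p′∈ q-lpd q′-lpd p≢p′ with <-cmp a b
  ... | tri< a<b _ _ = <⇒≢ (largestPrimeDivisor-<-later a≥2 a<b p∈ p′∈ q-lpd q′-lpd)
  ... | tri≈ _ refl _ = largestPrimeDivisor-≢-same-base a≥2 a≤K p∈ p′∈ p≢p′ q-lpd q′-lpd
  ... | tri> _ _ b<a = ≢-sym (<⇒≢ (largestPrimeDivisor-<-later b≥2 b<a p′∈ p∈ q′-lpd q-lpd))

  M≤sumRecip-block : ∀ a → ℕtoℚ M ≤ℚ sumRecip (block a)
  M≤sumRecip-block a = ℕtoℚ≤sumRecip M (block a)
    (ℚᵘ.≤-trans (*≤*⇒/≤/ M (2 * M) 1 2 (≤-reflexive (trans (*-comm M 2) (sym (*-identityʳ (2 * M))))))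
                (proj₂ (proj₂ (primesIn-sumRecip≥ (lower a) (2 * M)))))

lemma2p1 : (K M : ℕ) → 2 ≤ K → K ≤ M →
    Σ (ℕ → List ℕ) λ 𝒫 →
      (∀ a → 2 ≤ a → a ≤ K → All Prime (𝒫 a) × Unique (𝒫 a))
      × (∀ a b → 2 ≤ a → a ≤ K → 2 ≤ b → b ≤ K → a ≢ b →
           ∀ p → p ∈ 𝒫 a → p ∈ 𝒫 b → ⊥)
      × (∀ a → 2 ≤ a → a ≤ K → ∀ p → p ∈ 𝒫 a →
           ∀ q → IsLargestPrimeDivisor (a ^ p ∸ 1) q → K < q)
      × (∀ a b → 2 ≤ a → a ≤ K → 2 ≤ b → b ≤ K →
           ∀ p p′ → p ∈ 𝒫 a → p′ ∈ 𝒫 b →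
           ∀ q q′ → IsLargestPrimeDivisor (a ^ p ∸ 1) q →
             IsLargestPrimeDivisor (b ^ p′ ∸ 1) q′ →
             p ≢ p′ → q ≢ q′)
      × (∀ a → 2 ≤ a → a ≤ K → ℕtoℚ M ≤ℚ sumRecip (𝒫 a))
lemma2p1 K M _ _ =
  block ,
  (λ a _ _ → All.tabulate (block-prime a) , primesIn-unique (lower a) (upper a)) ,
  (λ a b a≥2 _ b≥2 _ a≢b p → blocks-disjoint a≥2 b≥2 a≢b) ,
  (λ a a≥2 _ p p∈ q → K<largestPrimeDivisor (<⇒≤ a≥2) p∈) ,
  (λ a b a≥2 a≤K b≥2 b≤K p p′ p∈ p′∈ q q′ →
     largestPrimeDivisors-distinct a≥2 a≤K b≥2 b≤K p∈ p′∈) ,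
  (λ a _ _ → M≤sumRecip-block a)
  where open Blocks K M
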